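{- Let $G$ be a directed unweighted graph with source $s$, sink $t$ and $(s,t)$-min-cut size $\lambda$. For any set $F$ of $k$ edges of $G$, $$\textsc{min-cut}(s,t,G-F)=\min\big\{\,|C|-|F_0| \;:\; C \text{ is a minimal } (s,t)\text{ -cut in } G \text{ with } |C|\le \lambda+k,\ F_0=F\cap C\,\big\}.$$
   Context: Edges have unit capacity. An $(s,t)$-cut is a set of edges whose removal leaves no $s$-to-$t$ path; it is minimal if no proper subset is an $(s,t)$-cut. $\textsc{min-cut}(s,t,H)$ is the minimum size of an $(s,t)$-cut in $H$, and $G-F$ is $G$ with the edges of $F$ deleted. -}

module Defs where

open import Data.Nat using (ℕ; _≤_)
open import Data.Fin using (Fin)
open import Data.Fin.Subset using (Subset; _∈_; _⊆_; _⊂_; _─_; ∣_∣)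
open import Data.Product using (Σ; _×_)
open import Relation.Binary.PropositionalEquality using (_≡_)
open import Relation.Nullary using (¬_)

-- Edges are drawn from an ambient
-- index set Fin m; each index has a tail and a head; the graph's edge set is
-- the subset 'edges' of present edge indices.  Edges have unit capacity.
record Graph (n : ℕ) : Set where
  field
    m     : ℕ
    tail  : Fin m → Fin n
    head  : Fin m → Fin n
    edges : Subset m
open Graph public

_−E_ : ∀ {n} (G : Graph n) → Subset (m G) → Graph n
G −E F = record { m = m G ; tail = tail G ; head = head G ; edges = edges G ─ F }

data Reach {n} (G : Graph n) : Fin n → Fin n → Set where
  here : ∀ {u} → Reach G u u
  step : ∀ {v} (e : Fin (m G)) → e ∈ edges G → Reach G (head G e) v → Reach G (tail G e) v

IsCut : ∀ {n} (G : Graph n) (s t : Fin n) → Subset (m G) → Set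
IsCut G s t C = C ⊆ edges G × ¬ Reach (G −E C) s t

IsMinimalCut : ∀ {n} (G : Graph n) (s t : Fin n) → Subset (m G) → Set
IsMinimalCut G s t C = IsCut G s t C × (∀ C' → C' ⊂ C → ¬ IsCut G s t C')

MinCut : ∀ {n} (G : Graph n) (s t : Fin n) → ℕ → Set
MinCut G s t λ′ = Σ (Subset (m G)) (λ C → IsCut G s t C × ∣ C ∣ ≡ λ′)
                × (∀ C → IsCut G s t C → λ′ ≤ ∣ C ∣)

-- Deleting F turns every (s,t)-cut C of G into the cut C ─ F of G − F, of size
-- |C| − |F ∩ C|.  Conversely, a minimum cut D of G − F has |D| ≤ λ, and D ∪ F is a
-- cut of G of size at most λ + k; a minimal cut C inside D ∪ F satisfies C ─ F ⊆ D,
-- so minimality of D forces |C| − |F ∩ C| = |D|.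
module Submission where

open import Defs
open import Data.Nat using (ℕ; suc; _≤_; _<_; _+_; _∸_; z≤n; s≤s; _<?_)
open import Data.Nat.Properties
  using (≤-refl; ≤-trans; ≤-antisym; ≤-reflexive; ≮⇒≥; <-irrefl; +-suc; +-mono-≤; +-monoʳ-≤; n≤1+n; m+n∸n≡m)
open import Data.Nat.Induction using (<-wellFounded)
open import Data.Fin using (Fin)
open import Data.Fin.Subset using (Subset; inside; outside; _∈_; _∉_; _⊆_; _⊂_; _⊃_; _∩_; _∪_; _─_; ⁅_⁆; ∣_∣)
open import Data.Fin.Subset.Properties
  using (_∈?_; _⊆?_; anySubset?; p⊆q⇒∣p∣≤∣q∣; p⊂q⇒∣p∣<∣q∣; ∣p─q∣≤∣p∣; p─q⊆p; p─q─r≡p─q∪r;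
         x∈p∧x∉q⇒x∈p─q; p⊆p∪q; x∈p∪q⁺; x∈p∪q⁻; ∪-comm; x∈⁅x⁆; x∈⁅y⁆⇒x≡y; ⊆-reflexive)
open import Data.Fin.Subset.Induction using (⊃-wellFounded)
open import Data.Fin.Properties using (any?)
open import Data.Vec using (_∷_; []; there)
open import Data.Product using (Σ; _×_; _,_; proj₁)
open import Data.Sum using (inj₁; inj₂)
open import Function using (_∘_)
open import Induction.WellFounded using (Acc; acc)
open import Level using (Level)
open import Relation.Binary.PropositionalEquality using (_≡_; refl; sym; trans; cong; subst)
open import Relation.Nullary using (Dec; yes; no; contradiction)
open import Relation.Nullary.Decidable using (_×-dec_; ¬?)
open import Relation.Unary using (Pred; Decidable)

private
  variable
    ℓ : Level
    k n : ℕ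

x∈p─q⁻ : ∀ {p q : Subset k} {x} → x ∈ p ─ q → x ∈ p × x ∉ q
x∈p─q⁻ {p = p} {q} x∈p─q = p─q⊆p p q x∈p─q , x∉q q x∈p─q
  where
  x∉q : ∀ {p : Subset k} (q : Subset k) {x} → x ∈ p ─ q → x ∉ q
  x∉q {p = _ ∷ _} (outside ∷ q) (there x∈p─q) (there x∈q) = x∉q q x∈p─q x∈q
  x∉q {p = _ ∷ _} (inside  ∷ q) (there x∈p─q) (there x∈q) = x∉q q x∈p─q x∈q

p⊆q∪r⇒p─r⊆q : ∀ {p q r : Subset k} → p ⊆ q ∪ r → p ─ r ⊆ q
p⊆q∪r⇒p─r⊆q {q = q} {r} p⊆q∪r x∈p─r with x∈p─q⁻ x∈p─r
... | x∈p , x∉r with x∈p∪q⁻ q r (p⊆q∪r x∈p)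
...   | inj₁ x∈q = x∈q
...   | inj₂ x∈r = contradiction x∈r x∉r

p⊂p∪⁅x⁆ : ∀ {p : Subset k} {x} → x ∉ p → p ⊂ p ∪ ⁅ x ⁆
p⊂p∪⁅x⁆ {p = p} {x} x∉p = p⊆p∪q ⁅ x ⁆ , x , x∈p∪q⁺ (inj₂ (x∈⁅x⁆ x)) , x∉p

∣p∪q∣≤∣p∣+∣q∣ : ∀ (p q : Subset k) → ∣ p ∪ q ∣ ≤ ∣ p ∣ + ∣ q ∣
∣p∪q∣≤∣p∣+∣q∣ []            []            = z≤n
∣p∪q∣≤∣p∣+∣q∣ (inside  ∷ p) (inside  ∷ q) = s≤s (≤-trans (∣p∪q∣≤∣p∣+∣q∣ p q) (+-monoʳ-≤ ∣ p ∣ (n≤1+n ∣ q ∣)))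
∣p∪q∣≤∣p∣+∣q∣ (inside  ∷ p) (outside ∷ q) = s≤s (∣p∪q∣≤∣p∣+∣q∣ p q)
∣p∪q∣≤∣p∣+∣q∣ (outside ∷ p) (inside  ∷ q) = ≤-trans (s≤s (∣p∪q∣≤∣p∣+∣q∣ p q)) (≤-reflexive (sym (+-suc ∣ p ∣ ∣ q ∣)))
∣p∪q∣≤∣p∣+∣q∣ (outside ∷ p) (outside ∷ q) = ∣p∪q∣≤∣p∣+∣q∣ p q

∣p∣≡∣p─q∣+∣q∩p∣ : ∀ (p q : Subset k) → ∣ p ∣ ≡ ∣ p ─ q ∣ + ∣ q ∩ p ∣
∣p∣≡∣p─q∣+∣q∩p∣ []            []            = refl
∣p∣≡∣p─q∣+∣q∩p∣ (inside  ∷ p) (inside  ∷ q) = trans (cong suc (∣p∣≡∣p─q∣+∣q∩p∣ p q)) (sym (+-suc _ _))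
∣p∣≡∣p─q∣+∣q∩p∣ (inside  ∷ p) (outside ∷ q) = cong suc (∣p∣≡∣p─q∣+∣q∩p∣ p q)
∣p∣≡∣p─q∣+∣q∩p∣ (outside ∷ p) (inside  ∷ q) = ∣p∣≡∣p─q∣+∣q∩p∣ p q
∣p∣≡∣p─q∣+∣q∩p∣ (outside ∷ p) (outside ∷ q) = ∣p∣≡∣p─q∣+∣q∩p∣ p q

∣p∣∸∣q∩p∣≡∣p─q∣ : ∀ (p q : Subset k) → ∣ p ∣ ∸ ∣ q ∩ p ∣ ≡ ∣ p ─ q ∣
∣p∣∸∣q∩p∣≡∣p─q∣ p q = trans (cong (_∸ ∣ q ∩ p ∣) (∣p∣≡∣p─q∣+∣q∩p∣ p q)) (m+n∸n≡m ∣ p ─ q ∣ ∣ q ∩ p ∣)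

minimum-size : ∀ {P : Pred (Subset k) ℓ} → Decidable P → ∀ {X} → P X →
               Σ (Subset k) λ C → P C × (∀ C′ → P C′ → ∣ C ∣ ≤ ∣ C′ ∣)
minimum-size {k = k} {P = P} P? {X} pX = go X (<-wellFounded ∣ X ∣) pX
  where
  go : ∀ X → Acc _<_ ∣ X ∣ → P X → Σ (Subset k) λ C → P C × (∀ C′ → P C′ → ∣ C ∣ ≤ ∣ C′ ∣)
  go X (acc smaller) pX with anySubset? (λ C → P? C ×-dec (∣ C ∣ <? ∣ X ∣))
  ... | yes (C , pC , ∣C∣<∣X∣) = go C (smaller ∣C∣<∣X∣) pC
  ... | no ∄smaller = X , pX , λ C′ pC′ → ≮⇒≥ (λ ∣C′∣<∣X∣ → ∄smaller (C′ , pC′ , ∣C′∣<∣X∣))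

withEdges : (G : Graph n) → Subset (m G) → Graph n
withEdges G A = record { m = m G ; tail = tail G ; head = head G ; edges = A }

Reach-mono : ∀ (G : Graph n) {A B : Subset (m G)} → A ⊆ B →
             ∀ {u v} → Reach (withEdges G A) u v → Reach (withEdges G B) u v
Reach-mono G A⊆B here            = here
Reach-mono G A⊆B (step e e∈A r) = step e (A⊆B e∈A) (Reach-mono G A⊆B r)

module _ (H : Graph n) where

  Closed : Subset n → Set
  Closed S = ∀ {e} → e ∈ edges H → tail H e ∈ S → head H e ∈ S

  Reach-snoc : ∀ {u e} → Reach H u (tail H e) → e ∈ edges H → Reach H u (head H e)
  Reach-snoc here           e∈E = step _ e∈E here
  Reach-snoc (step e′ e′∈E r) e∈E = step e′ e′∈E (Reach-snoc r e∈E)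

  Closed-Reach : ∀ {S} → Closed S → ∀ {u v} → Reach H u v → u ∈ S → v ∈ S
  Closed-Reach closed here           u∈S = u∈S
  Closed-Reach closed (step e e∈E r) u∈S = Closed-Reach closed r (closed e∈E u∈S)

  reachable-closure : ∀ u → Σ (Subset n) λ S → u ∈ S × Closed S × (∀ {v} → v ∈ S → Reach H u v)
  reachable-closure u = grow ⁅ u ⁆ (⊃-wellFounded _) (x∈⁅x⁆ u)
                             (λ v∈⁅u⁆ → subst (Reach H u) (sym (x∈⁅y⁆⇒x≡y u v∈⁅u⁆)) here)
    where
    grow : ∀ R → Acc _⊃_ R → u ∈ R → (∀ {v} → v ∈ R → Reach H u v) →
           Σ (Subset n) λ S → u ∈ S × Closed S × (∀ {v} → v ∈ S → Reach H u v)
    grow R (acc larger) u∈R sound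
      with any? (λ e → (e ∈? edges H) ×-dec (tail H e ∈? R) ×-dec ¬? (head H e ∈? R))
    ... | yes (e , e∈E , tail∈R , head∉R) =
      grow (R ∪ ⁅ head H e ⁆) (larger (p⊂p∪⁅x⁆ head∉R)) (x∈p∪q⁺ (inj₁ u∈R)) sound′
      where
      sound′ : ∀ {v} → v ∈ R ∪ ⁅ head H e ⁆ → Reach H u v
      sound′ v∈ with x∈p∪q⁻ R ⁅ head H e ⁆ v∈
      ... | inj₁ v∈R = sound v∈R
      ... | inj₂ v∈⁅head⁆ = subst (Reach H u) (sym (x∈⁅y⁆⇒x≡y _ v∈⁅head⁆)) (Reach-snoc (sound tail∈R) e∈E)
    ... | no ∄exit = R , u∈R , closed , sound
      where
      closed : Closed R
      closed {e} e∈E tail∈R with head H e ∈? R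
      ... | yes head∈R = head∈R
      ... | no head∉R = contradiction (e , e∈E , tail∈R , head∉R) ∄exit

  Reach? : ∀ u v → Dec (Reach H u v)
  Reach? u v with reachable-closure u
  ... | S , u∈S , closed , sound with v ∈? S
  ...   | yes v∈S = yes (sound v∈S)
  ...   | no v∉S = no (λ r → v∉S (Closed-Reach closed r u∈S))

module _ (G : Graph n) (s t : Fin n) where

  IsCut? : Decidable (IsCut G s t)
  IsCut? C = (C ⊆? edges G) ×-dec ¬? (Reach? (G −E C) s t)

  IsCut-─ : ∀ {F C} → IsCut G s t C → IsCut (G −E F) s t (C ─ F)
  IsCut-─ {F} {C} (C⊆E , ¬reach) = C─F⊆E─F , ¬reach ∘ Reach-mono G E─F─[C─F]⊆E─C
    where
    C─F⊆E─F : C ─ F ⊆ edges G ─ F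
    C─F⊆E─F x∈C─F with x∈p─q⁻ x∈C─F
    ... | x∈C , x∉F = x∈p∧x∉q⇒x∈p─q (C⊆E x∈C) x∉F
    E─F─[C─F]⊆E─C : (edges G ─ F) ─ (C ─ F) ⊆ edges G ─ C
    E─F─[C─F]⊆E─C x∈ with x∈p─q⁻ x∈
    ... | x∈E─F , x∉C─F with x∈p─q⁻ x∈E─F
    ...   | x∈E , x∉F = x∈p∧x∉q⇒x∈p─q x∈E (λ x∈C → x∉C─F (x∈p∧x∉q⇒x∈p─q x∈C x∉F))

  IsCut-∪ : ∀ {F D} → F ⊆ edges G → IsCut (G −E F) s t D → IsCut G s t (D ∪ F)
  IsCut-∪ {F} {D} F⊆E (D⊆E─F , ¬reach) = D∪F⊆E , ¬reach ∘ Reach-mono G (⊆-reflexive E─[D∪F]≡E─F─D)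
    where
    D∪F⊆E : D ∪ F ⊆ edges G
    D∪F⊆E x∈D∪F with x∈p∪q⁻ D F x∈D∪F
    ... | inj₁ x∈D = proj₁ (x∈p─q⁻ (D⊆E─F x∈D))
    ... | inj₂ x∈F = F⊆E x∈F
    E─[D∪F]≡E─F─D : edges G ─ (D ∪ F) ≡ (edges G ─ F) ─ D
    E─[D∪F]≡E─F─D = trans (cong (edges G ─_) (∪-comm D F)) (sym (p─q─r≡p─q∪r (edges G) F D))

  -- A cut of least size among those inside X is a minimal cut.
  minimal-cut-⊆ : ∀ {X} → IsCut G s t X → Σ (Subset (m G)) λ C → IsMinimalCut G s t C × C ⊆ X
  minimal-cut-⊆ {X} X-cut with minimum-size (λ C → IsCut? C ×-dec (C ⊆? X)) (X-cut , λ x∈X → x∈X)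
  ... | C , (C-cut , C⊆X) , least =
    C , (C-cut , λ C′ C′⊂C C′-cut → <-irrefl refl
                   (≤-trans (p⊂q⇒∣p∣<∣q∣ C′⊂C) (least C′ (C′-cut , C⊆X ∘ proj₁ C′⊂C)))) , C⊆X

lemma8 : ∀ {n} (G : Graph n) (s t : Fin n) (λ′ : ℕ) → MinCut G s t λ′ →
    (k : ℕ) (F : Subset (m G)) → F ⊆ edges G → ∣ F ∣ ≡ k →
    Σ ℕ (λ μ → MinCut (G −E F) s t μ
    × Σ (Subset (m G)) (λ C → IsMinimalCut G s t C × ∣ C ∣ ≤ λ′ + k × ∣ C ∣ ∸ ∣ F ∩ C ∣ ≡ μ)
    × (∀ C → IsMinimalCut G s t C → ∣ C ∣ ≤ λ′ + k → μ ≤ ∣ C ∣ ∸ ∣ F ∩ C ∣))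
lemma8 G s t λ′ ((C₀ , C₀-cut , ∣C₀∣≡λ′) , _) k F F⊆E refl
  with minimum-size (IsCut? (G −E F) s t) (IsCut-─ G s t C₀-cut)
... | D , D-cut , D-least
  with minimal-cut-⊆ G s t (IsCut-∪ G s t F⊆E D-cut)
... | C , C-minimal , C⊆D∪F =
  ∣ D ∣ , ((D , D-cut , refl) , D-least) , (C , C-minimal , ∣C∣≤λ′+k , ∣C─F∣≡∣D∣) , D-below
  where
  D-below : ∀ C → IsMinimalCut G s t C → ∣ C ∣ ≤ λ′ + ∣ F ∣ → ∣ D ∣ ≤ ∣ C ∣ ∸ ∣ F ∩ C ∣
  D-below C (C-cut , _) _ = subst (∣ D ∣ ≤_) (sym (∣p∣∸∣q∩p∣≡∣p─q∣ C F)) (D-least _ (IsCut-─ G s t C-cut))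

  ∣D∣≤λ′ : ∣ D ∣ ≤ λ′
  ∣D∣≤λ′ = ≤-trans (D-least _ (IsCut-─ G s t C₀-cut)) (subst (∣ C₀ ─ F ∣ ≤_) ∣C₀∣≡λ′ (∣p─q∣≤∣p∣ C₀ F))

  ∣C∣≤λ′+k : ∣ C ∣ ≤ λ′ + ∣ F ∣
  ∣C∣≤λ′+k = ≤-trans (p⊆q⇒∣p∣≤∣q∣ C⊆D∪F) (≤-trans (∣p∪q∣≤∣p∣+∣q∣ D F) (+-mono-≤ ∣D∣≤λ′ ≤-refl))

  ∣C─F∣≡∣D∣ : ∣ C ∣ ∸ ∣ F ∩ C ∣ ≡ ∣ D ∣
  ∣C─F∣≡∣D∣ = trans (∣p∣∸∣q∩p∣≡∣p─q∣ C F)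
    (≤-antisym (p⊆q⇒∣p∣≤∣q∣ (p⊆q∪r⇒p─r⊆q C⊆D∪F)) (D-least _ (IsCut-─ G s t (proj₁ C-minimal))))
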